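{- Let $a,b$ be positive integers and let $\mathcal{C}_{a,b}$ denote the class of cographs that contain neither $K_a$ nor $K_{b,b}$ as a subgraph. Then every graph in $\mathcal{C}_{a,b}$ has tree-depth at most $1+(a-1)(b-1)$.
   Context: A cograph is a graph that can be built from single vertices by disjoint unions and joins (equivalently, a graph with no induced path on four vertices). The depth of a rooted tree is the maximum number of vertices on a root-to-leaf path; the tree-depth of a graph $G$ is the smallest depth of a rooted forest on the vertex set of $G$ in which every edge of $G$ joins an ancestor–descendant pair. -}

module Defs where

open import Data.Nat using (ℕ; zero; suc; _≤_)
open import Data.Fin using (Fin)
open import Data.Fin.Subset using (Subset; _∈_; _∉_; _∪_; ⁅_⁆)
  renaming (⊥ to ∅; ⊤ to full)
open import Data.Maybe using (Maybe; just; nothing)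
open import Data.Product using (Σ; _×_; ∃; _,_)
open import Data.Sum using (_⊎_; inj₁; inj₂)
open import Data.Empty using (⊥)
open import Relation.Nullary using (¬_)
open import Relation.Binary.PropositionalEquality using (_≡_)
open import Function.Definitions using (Injective)

record Graph (n : ℕ) : Set₁ where
  field
    Adj    : Fin n → Fin n → Set
    sym    : ∀ {u v} → Adj u v → Adj v u
    irrefl : ∀ {u} → ¬ Adj u u
open Graph public

-- Cographs, following the definition "built from single vertices by disjoint
-- unions and joins": CoSet G S means that the induced subgraph G[S] is a cograph.
data CoSet {n : ℕ} (G : Graph n) : Subset n → Set where
  co-empty  : CoSet G ∅
  co-single : (v : Fin n) → CoSet G ⁅ v ⁆
  co-union  : ∀ {A B} → CoSet G A → CoSet G B
            → (∀ v → v ∈ A → v ∉ B)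
            → (∀ u v → u ∈ A → v ∈ B → ¬ Adj G u v)
            → CoSet G (A ∪ B)
  co-join   : ∀ {A B} → CoSet G A → CoSet G B
            → (∀ v → v ∈ A → v ∉ B)
            → (∀ u v → u ∈ A → v ∈ B → Adj G u v)
            → CoSet G (A ∪ B)

Cograph : {n : ℕ} → Graph n → Set
Cograph G = CoSet G full

ContainsK : {n : ℕ} → ℕ → Graph n → Set
ContainsK {n} a G =
  Σ (Fin a → Fin n) λ f → Injective _≡_ _≡_ f × (∀ i j → ¬ i ≡ j → Adj G (f i) (f j))

ContainsKbb : {n : ℕ} → ℕ → Graph n → Set
ContainsKbb {n} b G =
  Σ (Fin b ⊎ Fin b → Fin n) λ f → Injective _≡_ _≡_ f
    × (∀ i j → Adj G (f (inj₁ i)) (f (inj₂ j)))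

-- The level map exists iff the parent map is acyclic, and it is then unique.
record RootedForest (n : ℕ) : Set where
  field
    parent      : Fin n → Maybe (Fin n)
    level       : Fin n → ℕ
    level-root  : ∀ v → parent v ≡ nothing → level v ≡ 1
    level-child : ∀ v u → parent v ≡ just u → level v ≡ suc (level u)
open RootedForest public

data Ancestor {n : ℕ} (F : RootedForest n) : Fin n → Fin n → Set where
  anc-refl : ∀ v → Ancestor F v v
  anc-step : ∀ {u w v} → Ancestor F u w → parent F v ≡ just w → Ancestor F u v

TreeDepth≤ : {n : ℕ} → Graph n → ℕ → Set
TreeDepth≤ {n} G d =
  Σ (RootedForest n) λ F →
    (∀ v → level F v ≤ d) ×
    (∀ u v → Adj G u v → Ancestor F u v ⊎ Ancestor F v u)

-- Induction along the cotree, building for every cograph a rooted forest in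
-- which every edge joins an ancestor–descendant pair. A disjoint union takes the
-- union of the two forests. For a join G[A] ⊗ G[B] without K_{b,b}, one side,
-- say A, has fewer than b vertices; put A as a path on top of a forest for B.
-- If A is nonempty, G[B] has no K_{a-1}, so by induction B needs at most
-- (a-2)(b-1) proper ancestors, and the path adds at most b-1 more.
module Submission where

open import Defs
open import Data.Nat using (ℕ; zero; suc; _≤_; _+_; _*_; _∸_; z≤n; s≤s; _≤?_)
open import Data.Nat.Properties
  using (≤-trans; ≤-reflexive; +-monoˡ-≤; +-monoʳ-≤; +-comm; +-identityʳ; m≤n+m; ≰⇒>)
open import Data.Fin using (Fin; zero; suc; inject≤)
open import Data.Fin.Properties using (_≟_; inject≤-injective)
open import Data.Fin.Subset using (Subset; _∈_; _∉_; _⊆_; _∪_; Nonempty)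
  renaming (⊥ to ∅; ⊤ to full)
open import Data.Fin.Subset.Properties
  using (_∈?_; ∉⊥; ∈⊤; x∈⁅y⁆⇒x≡y; x∈p∪q⁻; p⊆p∪q; q⊆p∪q; ∪-comm)
open import Data.List using (List; []; _∷_; _++_; length; filter; allFin; lookup; head)
open import Data.List.Properties using (length-++)
open import Data.List.Membership.Propositional using () renaming (_∈_ to _∈ˡ_)
open import Data.List.Membership.Propositional.Properties
  using (∈-++⁺ˡ; ∈-++⁺ʳ; ∈-++⁻; ∈-filter⁺; ∈-filter⁻; ∈-allFin; ∈-lookup)
open import Data.List.Relation.Unary.All as All using (All)
open import Data.List.Relation.Unary.Any using (here; there)
open import Data.List.Relation.Unary.AllPairs using (_∷_)
open import Data.List.Relation.Unary.Unique.Propositional using (Unique)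
open import Data.List.Relation.Unary.Unique.Propositional.Properties using (allFin⁺; filter⁺)
open import Data.Bool using (if_then_else_)
open import Data.Maybe using (just; nothing)
open import Data.Product using (Σ; _×_; _,_; proj₂)
open import Data.Sum as Sum using (_⊎_; inj₁; inj₂; [_,_])
open import Data.Empty using (⊥-elim)
open import Function using (_∘_)
open import Function.Definitions using (Injective)
open import Relation.Nullary using (¬_; yes; no; does; contradiction)
open import Relation.Nullary.Decidable using (dec-true; dec-false)
open import Relation.Binary.Definitions using (DecidableEquality)
open import Relation.Binary.PropositionalEquality
  using (_≡_; _≢_; refl; trans; cong; subst; module ≡-Reasoning) renaming (sym to ≡-sym)

module _ {ℓ} {A : Set ℓ} where

  ∈-head : ∀ {xs ys : List A} {w} → xs ≡ w ∷ ys → w ∈ˡ xs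
  ∈-head refl = here refl

  head≡nothing⁻ : ∀ {xs : List A} → head xs ≡ nothing → xs ≡ []
  head≡nothing⁻ {[]} _ = refl

  head≡just⁻ : ∀ {xs : List A} {u} → head xs ≡ just u → Σ (List A) λ ws → xs ≡ u ∷ ws
  head≡just⁻ {x ∷ xs} refl = xs , refl

  ≢-head : ∀ {y w} {ys : List A} → All (y ≢_) ys → w ∈ˡ ys → w ≢ y
  ≢-head y∉ys w∈ys w≡y = All.lookup y∉ys w∈ys (≡-sym w≡y)

  ++-≡-∷ : ∀ (xs : List A) {ys w ws} → xs ++ ys ≡ w ∷ ws →
    (Σ (List A) λ vs → xs ≡ w ∷ vs × ws ≡ vs ++ ys) ⊎ ys ≡ w ∷ ws
  ++-≡-∷ []       eq   = inj₂ eq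
  ++-≡-∷ (x ∷ xs) refl = inj₁ (xs , refl , refl)

  lookup-injective : ∀ {xs : List A} → Unique xs → ∀ {i j} → lookup xs i ≡ lookup xs j → i ≡ j
  lookup-injective (_ ∷ _)     {zero}  {zero}  _  = refl
  lookup-injective (y∉ys ∷ _)  {zero}  {suc j} eq = contradiction (≡-sym eq) (≢-head y∉ys (∈-lookup j))
  lookup-injective (y∉ys ∷ _)  {suc i} {zero}  eq = contradiction eq (≢-head y∉ys (∈-lookup i))
  lookup-injective (_ ∷ uniq)  {suc i} {suc j} eq = cong suc (lookup-injective uniq eq)

  unique-injection : ∀ {k} {xs : List A} → Unique xs → k ≤ length xs →
    Σ (Fin k → A) λ f → Injective _≡_ _≡_ f × (∀ i → f i ∈ˡ xs)
  unique-injection {xs = xs} uniq k≤ =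
    (λ i → lookup xs (inject≤ i k≤)) ,
    (λ eq → inject≤-injective k≤ k≤ _ _ (lookup-injective uniq eq)) ,
    (λ i → ∈-lookup (inject≤ i k≤))

module _ {ℓ} {A : Set ℓ} (_≟ᴬ_ : DecidableEquality A) where

  after : A → List A → List A
  after v []       = []
  after v (y ∷ ys) with v ≟ᴬ y
  ... | yes _ = ys
  ... | no  _ = after v ys

  after-here : ∀ y ys → after y (y ∷ ys) ≡ ys
  after-here y ys with y ≟ᴬ y
  ... | yes _   = refl
  ... | no  y≢y = contradiction refl y≢y

  after-there : ∀ {u y} ys → u ≢ y → after u (y ∷ ys) ≡ after u ys
  after-there {u} {y} ys u≢y with u ≟ᴬ y
  ... | yes u≡y = contradiction u≡y u≢y
  ... | no  _   = refl

  ∈-after⁻ : ∀ {u} v xs → u ∈ˡ after v xs → u ∈ˡ xs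
  ∈-after⁻ v (y ∷ ys) u∈ with v ≟ᴬ y
  ... | yes _ = there u∈
  ... | no  _ = there (∈-after⁻ v ys u∈)

  length-after : ∀ v xs → length (after v xs) ≤ length xs
  length-after v []       = z≤n
  length-after v (y ∷ ys) with v ≟ᴬ y
  ... | yes _ = m≤n+m (length ys) 1
  ... | no  _ = ≤-trans (length-after v ys) (m≤n+m (length ys) 1)

  after-next : ∀ {xs} → Unique xs → ∀ {v w ws} → after v xs ≡ w ∷ ws → after w xs ≡ ws
  after-next {y ∷ ys} (y∉ys ∷ uniq) {v} {w} {ws} eq with v ≟ᴬ y
  ... | yes _ = begin
    after w (y ∷ ys)   ≡⟨ after-there ys (≢-head y∉ys (∈-head eq)) ⟩
    after w ys         ≡⟨ cong (after w) eq ⟩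
    after w (w ∷ ws)   ≡⟨ after-here w ws ⟩
    ws                 ∎
    where open ≡-Reasoning
  ... | no  _ = trans (after-there ys (≢-head y∉ys (∈-after⁻ v ys (∈-head eq))))
                      (after-next uniq eq)

  after-comparable : ∀ {xs u v} → Unique xs → u ∈ˡ xs → v ∈ˡ xs → u ≢ v →
    u ∈ˡ after v xs ⊎ v ∈ˡ after u xs
  after-comparable {y ∷ ys} (_ ∷ _) (here refl) (here refl) u≢v = contradiction refl u≢v
  after-comparable {y ∷ ys} (_ ∷ _) (here refl) (there v∈) _ rewrite after-here y ys = inj₂ v∈
  after-comparable {y ∷ ys} (_ ∷ _) (there u∈) (here refl) _ rewrite after-here y ys = inj₁ u∈
  after-comparable {y ∷ ys} {u} {v} (y∉ys ∷ uniq) (there u∈) (there v∈) u≢v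
    rewrite after-there ys (≢-head y∉ys u∈) | after-there ys (≢-head y∉ys v∈) =
    after-comparable uniq u∈ v∈ u≢v

module _ {n : ℕ} where

  elements : Subset n → List (Fin n)
  elements S = filter (_∈? S) (allFin n)

  elements-unique : ∀ S → Unique (elements S)
  elements-unique S = filter⁺ (_∈? S) (allFin⁺ n)

  ∈-elements⁺ : ∀ {S u} → u ∈ S → u ∈ˡ elements S
  ∈-elements⁺ {S} {u} = ∈-filter⁺ (_∈? S) (∈-allFin u)

  ∈-elements⁻ : ∀ {S u} → u ∈ˡ elements S → u ∈ S
  ∈-elements⁻ {S} = proj₂ ∘ ∈-filter⁻ (_∈? S) {xs = allFin n}

  elements-empty-or-nonempty : ∀ S → length (elements S) ≡ 0 ⊎ Nonempty S
  elements-empty-or-nonempty S with elements S in eq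
  ... | []    = inj₁ refl
  ... | x ∷ _ = inj₂ (x , ∈-elements⁻ (∈-head eq))

  -- Opaque, so that a `with v ∈? S` in a client does not unfold select.
  opaque
    select : ∀ {ℓ} {X : Set ℓ} → Subset n → (Fin n → X) → (Fin n → X) → Fin n → X
    select S f g v = if does (v ∈? S) then f v else g v

    select-∈ : ∀ {ℓ} {X : Set ℓ} {S} {f g : Fin n → X} {v} → v ∈ S → select S f g v ≡ f v
    select-∈ {S = S} {v = v} v∈S rewrite dec-true (v ∈? S) v∈S = refl

    select-∉ : ∀ {ℓ} {X : Set ℓ} {S} {f g : Fin n → X} {v} → v ∉ S → select S f g v ≡ g v
    select-∉ {S = S} {v = v} v∉S rewrite dec-false (v ∈? S) v∉S = refl

  Disjoint : Subset n → Subset n → Set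
  Disjoint A B = ∀ v → v ∈ A → v ∉ B

module _ {n : ℕ} (G : Graph n) where

  Anticomplete Complete : Subset n → Subset n → Set
  Anticomplete A B = ∀ u v → u ∈ A → v ∈ B → ¬ Adj G u v
  Complete     A B = ∀ u v → u ∈ A → v ∈ B → Adj G u v

  HasClique : Subset n → ℕ → Set
  HasClique S k = Σ (Fin k → Fin n) λ f → Injective _≡_ _≡_ f × (∀ i → f i ∈ S)
    × (∀ i j → i ≢ j → Adj G (f i) (f j))

  HasBiclique : Subset n → ℕ → Set
  HasBiclique S k = Σ (Fin k ⊎ Fin k → Fin n) λ f → Injective _≡_ _≡_ f × (∀ x → f x ∈ S)
    × (∀ i j → Adj G (f (inj₁ i)) (f (inj₂ j)))

  clique-mono : ∀ {S T k} → S ⊆ T → HasClique S k → HasClique T k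
  clique-mono S⊆T (f , f-inj , f∈S , f-adj) = f , f-inj , S⊆T ∘ f∈S , f-adj

  biclique-mono : ∀ {S T k} → S ⊆ T → HasBiclique S k → HasBiclique T k
  biclique-mono S⊆T (f , f-inj , f∈S , f-adj) = f , f-inj , S⊆T ∘ f∈S , f-adj

  empty-clique : ∀ {S} → HasClique S 0
  empty-clique = (λ ()) , (λ { {()} }) , (λ ()) , (λ ())

  clique-extend : ∀ {X Y k x} → x ∈ X → Disjoint X Y → Complete X Y →
    HasClique Y k → HasClique (X ∪ Y) (suc k)
  clique-extend {X} {Y} {k} {x} x∈X X∩Y=∅ X⊗Y (f , f-inj , f∈Y , f-adj) =
    g , g-inj , g∈X∪Y , g-adj
    where
    g : Fin (suc k) → Fin n
    g zero    = x
    g (suc i) = f i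
    x∉f : ∀ i → x ≢ f i
    x∉f i x≡fi = X∩Y=∅ x x∈X (subst (_∈ Y) (≡-sym x≡fi) (f∈Y i))
    g-inj : Injective _≡_ _≡_ g
    g-inj {zero}  {zero}  _  = refl
    g-inj {zero}  {suc j} eq = contradiction eq (x∉f j)
    g-inj {suc i} {zero}  eq = contradiction (≡-sym eq) (x∉f i)
    g-inj {suc i} {suc j} eq = cong suc (f-inj eq)
    g∈X∪Y : ∀ i → g i ∈ X ∪ Y
    g∈X∪Y zero    = p⊆p∪q Y x∈X
    g∈X∪Y (suc i) = q⊆p∪q X Y (f∈Y i)
    g-adj : ∀ i j → i ≢ j → Adj G (g i) (g j)
    g-adj zero    zero    i≢j = contradiction refl i≢j
    g-adj zero    (suc j) _   = X⊗Y x (f j) x∈X (f∈Y j)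
    g-adj (suc i) zero    _   = sym G (X⊗Y x (f i) x∈X (f∈Y i))
    g-adj (suc i) (suc j) i≢j = f-adj i j (i≢j ∘ cong suc)

  biclique-of-large-sides : ∀ {X Y k} → Disjoint X Y → Complete X Y →
    k ≤ length (elements X) → k ≤ length (elements Y) → HasBiclique (X ∪ Y) k
  biclique-of-large-sides {X} {Y} X∩Y=∅ X⊗Y k≤X k≤Y
    with unique-injection (elements-unique X) k≤X | unique-injection (elements-unique Y) k≤Y
  ... | f , f-inj , f∈X | g , g-inj , g∈Y = [ f , g ] , fg-inj , fg∈X∪Y , fg-adj
    where
    X∌g : ∀ i j → f i ≢ g j
    X∌g i j fi≡gj =
      X∩Y=∅ _ (∈-elements⁻ (f∈X i)) (subst (_∈ Y) (≡-sym fi≡gj) (∈-elements⁻ (g∈Y j)))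
    fg-inj : Injective _≡_ _≡_ [ f , g ]
    fg-inj {inj₁ i} {inj₁ j} eq = cong inj₁ (f-inj eq)
    fg-inj {inj₁ i} {inj₂ j} eq = contradiction eq (X∌g i j)
    fg-inj {inj₂ i} {inj₁ j} eq = contradiction (≡-sym eq) (X∌g j i)
    fg-inj {inj₂ i} {inj₂ j} eq = cong inj₂ (g-inj eq)
    fg∈X∪Y : ∀ x → [ f , g ] x ∈ X ∪ Y
    fg∈X∪Y (inj₁ i) = p⊆p∪q Y (∈-elements⁻ (f∈X i))
    fg∈X∪Y (inj₂ j) = q⊆p∪q X Y (∈-elements⁻ (g∈Y j))
    fg-adj : ∀ i j → Adj G (f i) (g j)
    fg-adj i j = X⊗Y _ _ (∈-elements⁻ (f∈X i)) (∈-elements⁻ (g∈Y j))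

  -- A rooted forest on S, each vertex v given by the list of its proper
  -- ancestors, parent first; d bounds the number of proper ancestors, so the
  -- depth is at most 1 + d. Lists of vertices outside S are irrelevant.
  record Forest (S : Subset n) (d : ℕ) : Set where
    field
      ancestors         : Fin n → List (Fin n)
      ancestors-next    : ∀ {v w ws} → ancestors v ≡ w ∷ ws → ancestors w ≡ ws
      ancestors⊆        : ∀ {u v} → u ∈ˡ ancestors v → u ∈ S
      ancestors-bounded : ∀ v → length (ancestors v) ≤ d
      edge-comparable   : ∀ {u v} → u ∈ S → v ∈ S → Adj G u v →
                          u ∈ˡ ancestors v ⊎ v ∈ˡ ancestors u
  open Forest

  forest-weaken : ∀ {S d d′} → d ≤ d′ → Forest S d → Forest S d′
  forest-weaken d≤d′ F = record
    { ancestors         = ancestors F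
    ; ancestors-next    = ancestors-next F
    ; ancestors⊆        = ancestors⊆ F
    ; ancestors-bounded = λ v → ≤-trans (ancestors-bounded F v) d≤d′
    ; edge-comparable   = edge-comparable F
    }

  forest-edgeless : ∀ {S d} → (∀ {u v} → u ∈ S → v ∈ S → ¬ Adj G u v) → Forest S d
  forest-edgeless no-edge = record
    { ancestors         = λ _ → []
    ; ancestors-next    = λ ()
    ; ancestors⊆        = λ ()
    ; ancestors-bounded = λ _ → z≤n
    ; edge-comparable   = λ u∈S v∈S uv → ⊥-elim (no-edge u∈S v∈S uv)
    }

  forest-∪ : ∀ {A B d} → Forest A d → Forest B d → Disjoint A B → Anticomplete A B →
    Forest (A ∪ B) d
  forest-∪ {A} {B} {d} FA FB A∩B=∅ A⊘B = record
    { ancestors         = anc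
    ; ancestors-next    = next
    ; ancestors⊆        = anc⊆
    ; ancestors-bounded = bounded
    ; edge-comparable   = comparable
    }
    where
    anc : Fin n → List (Fin n)
    anc = select A (ancestors FA) (ancestors FB)

    anc-A : ∀ {v} → v ∈ A → anc v ≡ ancestors FA v
    anc-A = select-∈ {f = ancestors FA} {g = ancestors FB}

    anc-B : ∀ {v} → v ∈ B → anc v ≡ ancestors FB v
    anc-B {v} v∈B = select-∉ {f = ancestors FA} {g = ancestors FB} (λ v∈A → A∩B=∅ v v∈A v∈B)

    next : ∀ {v w ws} → anc v ≡ w ∷ ws → anc w ≡ ws
    next {v} eq with v ∈? A
    ... | yes v∈A = let eqA = trans (≡-sym (anc-A v∈A)) eq in
      trans (anc-A (ancestors⊆ FA (∈-head eqA))) (ancestors-next FA eqA)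
    ... | no  v∉A = let eqB = trans (≡-sym (select-∉ v∉A)) eq in
      trans (anc-B (ancestors⊆ FB (∈-head eqB))) (ancestors-next FB eqB)

    anc⊆ : ∀ {u v} → u ∈ˡ anc v → u ∈ A ∪ B
    anc⊆ {u} {v} u∈ with v ∈? A
    ... | yes v∈A = p⊆p∪q B (ancestors⊆ FA (subst (u ∈ˡ_) (anc-A v∈A) u∈))
    ... | no  v∉A = q⊆p∪q A B (ancestors⊆ FB (subst (u ∈ˡ_) (select-∉ v∉A) u∈))

    bounded : ∀ v → length (anc v) ≤ d
    bounded v with v ∈? A
    ... | yes v∈A = subst (λ l → length l ≤ d) (≡-sym (anc-A v∈A)) (ancestors-bounded FA v)
    ... | no  v∉A = subst (λ l → length l ≤ d) (≡-sym (select-∉ v∉A)) (ancestors-bounded FB v)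

    comparable : ∀ {u v} → u ∈ A ∪ B → v ∈ A ∪ B → Adj G u v → u ∈ˡ anc v ⊎ v ∈ˡ anc u
    comparable {u} {v} u∈ v∈ uv with x∈p∪q⁻ A B u∈ | x∈p∪q⁻ A B v∈
    ... | inj₁ u∈A | inj₁ v∈A rewrite anc-A u∈A | anc-A v∈A = edge-comparable FA u∈A v∈A uv
    ... | inj₁ u∈A | inj₂ v∈B = ⊥-elim (A⊘B u v u∈A v∈B uv)
    ... | inj₂ u∈B | inj₁ v∈A = ⊥-elim (A⊘B v u v∈A u∈B (sym G uv))
    ... | inj₂ u∈B | inj₂ v∈B rewrite anc-B u∈B | anc-B v∈B = edge-comparable FB u∈B v∈B uv

  -- The vertices of X, in the order of elements X, form a path above all roots of the forest on Y.
  forest-∪-path : ∀ {X Y d} → Forest Y d → Disjoint X Y → Forest (X ∪ Y) (d + length (elements X))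
  forest-∪-path {X} {Y} {d} FY X∩Y=∅ = record
    { ancestors         = anc
    ; ancestors-next    = next
    ; ancestors⊆        = anc⊆
    ; ancestors-bounded = bounded
    ; edge-comparable   = comparable
    }
    where
    L : List (Fin n)
    L = elements X

    anc : Fin n → List (Fin n)
    anc = select Y (λ v → ancestors FY v ++ L) (λ v → after _≟_ v L)

    anc-Y : ∀ {v} → v ∈ Y → anc v ≡ ancestors FY v ++ L
    anc-Y = select-∈ {f = λ v → ancestors FY v ++ L} {g = λ v → after _≟_ v L}

    anc-L : ∀ {v} → v ∈ˡ L → anc v ≡ after _≟_ v L
    anc-L {v} v∈L = select-∉ {f = λ v → ancestors FY v ++ L} {g = λ v → after _≟_ v L}
      (X∩Y=∅ v (∈-elements⁻ v∈L))

    next : ∀ {v w ws} → anc v ≡ w ∷ ws → anc w ≡ ws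
    next {v} {w} {ws} eq with v ∈? Y
    ... | no v∉Y = let eqL = trans (≡-sym (select-∉ v∉Y)) eq in
      trans (anc-L (∈-after⁻ _≟_ v L (∈-head eqL))) (after-next _≟_ (elements-unique X) eqL)
    ... | yes v∈Y with ++-≡-∷ (ancestors FY v) (trans (≡-sym (anc-Y v∈Y)) eq)
    ...   | inj₁ (vs , eqY , ws≡) =
      trans (anc-Y (ancestors⊆ FY (∈-head eqY)))
            (trans (cong (_++ L) (ancestors-next FY eqY)) (≡-sym ws≡))
    ...   | inj₂ L≡ =
      trans (anc-L (∈-head L≡))
            (trans (cong (after _≟_ w) L≡) (after-here _≟_ w ws))

    anc⊆ : ∀ {u v} → u ∈ˡ anc v → u ∈ X ∪ Y
    anc⊆ {u} {v} u∈ with v ∈? Y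
    ... | no v∉Y =
      p⊆p∪q Y (∈-elements⁻ (∈-after⁻ _≟_ v L (subst (u ∈ˡ_) (select-∉ v∉Y) u∈)))
    ... | yes v∈Y with ∈-++⁻ (ancestors FY v) (subst (u ∈ˡ_) (anc-Y v∈Y) u∈)
    ...   | inj₁ u∈anc = q⊆p∪q X Y (ancestors⊆ FY u∈anc)
    ...   | inj₂ u∈L   = p⊆p∪q Y (∈-elements⁻ u∈L)

    bounded : ∀ v → length (anc v) ≤ d + length L
    bounded v with v ∈? Y
    ... | no v∉Y = subst (λ l → length l ≤ d + length L) (≡-sym (select-∉ v∉Y))
                         (≤-trans (length-after _≟_ v L) (m≤n+m (length L) d))
    ... | yes v∈Y = subst (λ l → length l ≤ d + length L) (≡-sym (anc-Y v∈Y))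
                          (subst (_≤ d + length L) (≡-sym (length-++ (ancestors FY v)))
                                 (+-monoˡ-≤ (length L) (ancestors-bounded FY v)))

    comparable : ∀ {u v} → u ∈ X ∪ Y → v ∈ X ∪ Y → Adj G u v → u ∈ˡ anc v ⊎ v ∈ˡ anc u
    comparable {u} {v} u∈ v∈ uv with x∈p∪q⁻ X Y u∈ | x∈p∪q⁻ X Y v∈
    ... | inj₁ u∈X | inj₁ v∈X
      rewrite anc-L (∈-elements⁺ u∈X) | anc-L (∈-elements⁺ v∈X) =
      after-comparable _≟_ (elements-unique X) (∈-elements⁺ u∈X) (∈-elements⁺ v∈X)
        (λ u≡v → irrefl G (subst (Adj G u) (≡-sym u≡v) uv))
    ... | inj₁ u∈X | inj₂ v∈Y rewrite anc-Y v∈Y =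
      inj₁ (∈-++⁺ʳ (ancestors FY v) (∈-elements⁺ u∈X))
    ... | inj₂ u∈Y | inj₁ v∈X rewrite anc-Y u∈Y =
      inj₂ (∈-++⁺ʳ (ancestors FY u) (∈-elements⁺ v∈X))
    ... | inj₂ u∈Y | inj₂ v∈Y rewrite anc-Y u∈Y | anc-Y v∈Y =
      Sum.map ∈-++⁺ˡ ∈-++⁺ˡ (edge-comparable FY u∈Y v∈Y uv)

  forest-∪-comm : ∀ {A B d} → Forest (B ∪ A) d → Forest (A ∪ B) d
  forest-∪-comm {A} {B} {d} = subst (λ S → Forest S d) (∪-comm B A)

  forest-join-small : ∀ {X Y c} a → Disjoint X Y → Complete X Y → length (elements X) ≤ c →
    (∀ a′ → ¬ HasClique Y (suc a′) → Forest Y (a′ * c)) →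
    ¬ HasClique (X ∪ Y) (suc a) → Forest (X ∪ Y) (a * c)
  forest-join-small {X} {Y} {c} a X∩Y=∅ X⊗Y |X|≤c forestY noK
    with elements-empty-or-nonempty X
  ... | inj₁ |X|≡0 =
    forest-weaken (≤-reflexive (trans (cong (a * c +_) |X|≡0) (+-identityʳ (a * c))))
      (forest-∪-path (forestY a (noK ∘ clique-mono (q⊆p∪q X Y))) X∩Y=∅)
  ... | inj₂ (x , x∈X) with a
  ...   | zero   = ⊥-elim (noK (clique-extend x∈X X∩Y=∅ X⊗Y empty-clique))
  ...   | suc a′ =
    forest-weaken (≤-trans (+-monoʳ-≤ (a′ * c) |X|≤c) (≤-reflexive (+-comm (a′ * c) c)))
      (forest-∪-path (forestY a′ (noK ∘ clique-extend x∈X X∩Y=∅ X⊗Y)) X∩Y=∅)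

  forest-of-cograph : ∀ {S} (c a : ℕ) → CoSet G S →
    ¬ HasClique S (suc a) → ¬ HasBiclique S (suc c) → Forest S (a * c)
  forest-of-cograph c a co-empty _ _ = forest-edgeless (λ u∈∅ _ _ → ∉⊥ u∈∅)
  forest-of-cograph c a (co-single x) _ _ = forest-edgeless λ {u} {v} u∈x v∈x uv →
    irrefl G (subst (Adj G u) (trans (x∈⁅y⁆⇒x≡y x v∈x) (≡-sym (x∈⁅y⁆⇒x≡y x u∈x))) uv)
  forest-of-cograph c a (co-union {A} {B} coA coB A∩B=∅ A⊘B) noK noB =
    forest-∪ (forest-of-cograph c a coA (noK ∘ clique-mono A⊆A∪B) (noB ∘ biclique-mono A⊆A∪B))
             (forest-of-cograph c a coB (noK ∘ clique-mono B⊆A∪B) (noB ∘ biclique-mono B⊆A∪B))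
             A∩B=∅ A⊘B
    where
    A⊆A∪B : A ⊆ A ∪ B
    A⊆A∪B = p⊆p∪q B
    B⊆A∪B : B ⊆ A ∪ B
    B⊆A∪B = q⊆p∪q A B
  forest-of-cograph c a (co-join {A} {B} coA coB A∩B=∅ A⊗B) noK noB
    with length (elements A) ≤? c | length (elements B) ≤? c
  ... | yes |A|≤c | _ =
    forest-join-small a A∩B=∅ A⊗B |A|≤c
      (λ a′ noKB → forest-of-cograph c a′ coB noKB (noB ∘ biclique-mono (q⊆p∪q A B))) noK
  ... | no _ | yes |B|≤c =
    forest-∪-comm (forest-join-small a B∩A=∅ B⊗A |B|≤c
      (λ a′ noKA → forest-of-cograph c a′ coA noKA (noB ∘ biclique-mono (p⊆p∪q B)))
      (noK ∘ subst (λ S → HasClique S (suc a)) (∪-comm B A)))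
    where
    B∩A=∅ : Disjoint B A
    B∩A=∅ v v∈B v∈A = A∩B=∅ v v∈A v∈B
    B⊗A : Complete B A
    B⊗A u v u∈B v∈A = sym G (A⊗B v u v∈A u∈B)
  ... | no |A|≰c | no |B|≰c =
    ⊥-elim (noB (biclique-of-large-sides A∩B=∅ A⊗B (≰⇒> |A|≰c) (≰⇒> |B|≰c)))

  tree-depth-of-forest : ∀ {d} → Forest full d → TreeDepth≤ G (suc d)
  tree-depth-of-forest {d} F = T , (λ v → s≤s (ancestors-bounded F v)) , comparable
    where
    anc : Fin n → List (Fin n)
    anc = ancestors F

    child-level : ∀ v u → head (anc v) ≡ just u → suc (length (anc v)) ≡ suc (suc (length (anc u)))
    child-level v u eq with head≡just⁻ eq
    ... | ws , eqv =
      trans (cong (λ xs → suc (length xs)) eqv)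
            (cong (λ xs → suc (suc (length xs))) (≡-sym (ancestors-next F eqv)))

    root-level : ∀ v → head (anc v) ≡ nothing → suc (length (anc v)) ≡ 1
    root-level v eq = cong (λ xs → suc (length xs)) (head≡nothing⁻ eq)

    T : RootedForest n
    T = record
      { parent      = head ∘ anc
      ; level       = λ v → suc (length (anc v))
      ; level-root  = root-level
      ; level-child = child-level
      }

    ancestor-of-∈ : ∀ {u} xs v → anc v ≡ xs → u ∈ˡ xs → Ancestor T u v
    ancestor-of-∈ (w ∷ ws) v eq (here refl) = anc-step (anc-refl w) (cong head eq)
    ancestor-of-∈ (w ∷ ws) v eq (there u∈) =
      anc-step (ancestor-of-∈ ws w (ancestors-next F eq) u∈) (cong head eq)

    comparable : ∀ u v → Adj G u v → Ancestor T u v ⊎ Ancestor T v u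
    comparable u v uv =
      Sum.map (ancestor-of-∈ (anc v) v refl) (ancestor-of-∈ (anc u) u refl)
        (edge-comparable F ∈⊤ ∈⊤ uv)

lemma6 : (a b : ℕ) → 1 ≤ a → 1 ≤ b → (n : ℕ) → (G : Graph n) →
    Cograph G → ¬ ContainsK a G → ¬ ContainsKbb b G →
    TreeDepth≤ G (1 + (a ∸ 1) * (b ∸ 1))
lemma6 (suc a) (suc c) _ _ n G cograph noK noKbb =
  tree-depth-of-forest G (forest-of-cograph G c a cograph
    (λ (f , f-inj , _ , f-adj) → noK (f , f-inj , f-adj))
    (λ (f , f-inj , _ , f-adj) → noKbb (f , f-inj , f-adj)))
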